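{- Let $G$ be a graph and let $G \vee K_1$ denote the join of $G$ with a single vertex. Then $F(G \vee K_1) = \alpha(G \vee K_1)$.
   Context: Peg solitaire on a graph: a configuration assigns to each vertex either a peg or a hole. If $x,y,z$ form a path $xyz$ with pegs at $x$ and $y$ and a hole at $z$, a jump $xyz$ removes the pegs at $x$ and $y$ and places a peg at $z$. A terminal state of a graph $G$ is the set of peg locations when no jump is available, reached by some sequence of jumps from a starting configuration with exactly one hole (and pegs on all other vertices); it is an independent set. The fool's solitaire number $F(G)$ is the maximum size of a terminal state of $G$. $\alpha(G)$ is the independence number. The join $G \vee H$ is obtained from the disjoint union of $G$ and $H$ by adding all edges between $V(G)$ and $V(H)$. -}

module Defs where

open import Data.Nat using (ℕ; suc; _≤_)
open import Data.Bool using (Bool; true; false)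
open import Data.Fin using (Fin; zero; suc)
open import Data.Fin.Subset using (Subset; _∈_; _∉_; ∁; ⁅_⁆; ∣_∣; inside; outside)
open import Data.Vec using (_[_]≔_)
open import Data.Product using (Σ; ∃; _×_)
open import Relation.Binary.PropositionalEquality using (_≡_; _≢_)
open import Relation.Binary.Construct.Closure.ReflexiveTransitive using (Star)
open import Relation.Nullary using (¬_)

record Graph (n : ℕ) : Set where
  field
    adj   : Fin n → Fin n → Bool
    sym   : ∀ x y → adj x y ≡ adj y x
    irrefl : ∀ x → adj x x ≡ false

open Graph public

_∼[_]_ : ∀ {n} → Fin n → Graph n → Fin n → Set
x ∼[ G ] y = adj G x y ≡ true

-- The join G ∨ K₁: the new vertex is 'zero', the vertices of G are 'suc i'.
joinAdj : ∀ {n} → Graph n → Fin (suc n) → Fin (suc n) → Bool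
joinAdj G zero    zero    = false
joinAdj G zero    (suc j) = true
joinAdj G (suc i) zero    = true
joinAdj G (suc i) (suc j) = adj G i j

joinSym : ∀ {n} (G : Graph n) x y → joinAdj G x y ≡ joinAdj G y x
joinSym G zero    zero    = Relation.Binary.PropositionalEquality.refl
joinSym G zero    (suc j) = Relation.Binary.PropositionalEquality.refl
joinSym G (suc i) zero    = Relation.Binary.PropositionalEquality.refl
joinSym G (suc i) (suc j) = sym G i j

joinIrrefl : ∀ {n} (G : Graph n) x → joinAdj G x x ≡ false
joinIrrefl G zero    = Relation.Binary.PropositionalEquality.refl
joinIrrefl G (suc i) = irrefl G i

joinK₁ : ∀ {n} → Graph n → Graph (suc n)
joinK₁ G = record { adj = joinAdj G ; sym = joinSym G ; irrefl = joinIrrefl G }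

-- Configurations: the set of vertices carrying a peg.
Config : ℕ → Set
Config n = Subset n

Jump : ∀ {n} → Graph n → Config n → Config n → Set
Jump G c c' =
  Σ _ λ x → Σ _ λ y → Σ _ λ z →
    x ∼[ G ] y × y ∼[ G ] z × x ≢ z ×
    x ∈ c × y ∈ c × z ∉ c ×
    c' ≡ (((c [ x ]≔ outside) [ y ]≔ outside) [ z ]≔ inside)

start : ∀ {n} → Fin n → Config n
start h = ∁ ⁅ h ⁆

Terminal : ∀ {n} → Graph n → Config n → Set
Terminal G T =
  (∃ λ h → Star (Jump G) (start h) T) × (∀ c' → ¬ Jump G T c')

Independent : ∀ {n} → Graph n → Subset n → Set
Independent G S = ∀ x y → x ∈ S → y ∈ S → ¬ (x ∼[ G ] y)

IsFoolsNumber : ∀ {n} → Graph n → ℕ → Set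
IsFoolsNumber G m =
  (∃ λ T → Terminal G T × ∣ T ∣ ≡ m) × (∀ T → Terminal G T → ∣ T ∣ ≤ m)

IsIndependenceNumber : ∀ {n} → Graph n → ℕ → Set
IsIndependenceNumber G m =
  (∃ λ S → Independent G S × ∣ S ∣ ≡ m) × (∀ S → Independent G S → ∣ S ∣ ≤ m)

-- A maximum independent set S of G is dominating, and it is reached in G ∨ K₁ from a
-- one-hole board by alternating two kinds of jumps, each removing a peg r ∉ S: with the
-- apex empty, r jumps over a neighbour s ∈ S into the apex; with the apex full and a
-- hole at s ∈ S, r jumps over the apex into s.  The parity of ∣V(G) ∖ S∣ decides whether
-- the initial hole is the apex or a vertex of S.  The board S admits no jump, so
-- F(G ∨ K₁) ≥ ∣S∣ = α(G ∨ K₁).  Conversely a terminal state has a hole, into which any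
-- two adjacent pegs could jump through the apex; so it is independent.
module Submission where

open import Defs
open import Data.Nat using (ℕ; suc; zero; _≤_; _<_; s≤s; z≤n; _≤?_)
open import Data.Nat.Properties using (≮⇒≥; ≤-refl; ≤-trans; <-≤-trans; <-irrefl)
open import Data.Nat.Induction using (<-wellFounded)
open import Data.Bool using (true; not)
open import Data.Bool.Properties using () renaming (_≟_ to _≟ᵇ_)
open import Data.Fin using (Fin; zero; suc; _≟_)
open import Data.Fin.Properties using (any?; all?; suc-injective)
open import Data.Fin.Subset
  using (Subset; _∈_; _∉_; _⊆_; _⊂_; _∪_; ∁; ⁅_⁆; ∣_∣; ⊥; ⊤; Nonempty; inside; outside)
open import Data.Fin.Subset.Properties
  using (_∈?_; anySubset?; drop-not-there; ∣p∣≤n; ∣⊥∣≡0; ∣⁅x⁆∣≡1; x∈⁅x⁆; x∈⁅y⁆⇒x≡y; x∈p⇒x∉∁p;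
         Empty-unique; nonempty?; ⊆-antisym; ⊆⊤; p⊆p∪q; x∈p∪q⁻; x∈p∪q⁺; p⊂q⇒∣p∣<∣q∣)
open import Data.Vec using (_∷_; _[_]≔_; _[_]=_; lookup; here; there)
open import Data.Vec.Properties
  using ([]=-injective; []≔-updates; []≔-minimal; []≔-commutes; []≔-idempotent;
         []≔-lookup; lookup∘update′; []=⇒lookup; map-replicate)
open import Data.Product using (∃; _×_; _,_; proj₂)
open import Data.Sum using (_⊎_; inj₁; inj₂)
open import Data.Empty using (⊥-elim)
open import Function using (_∘_)
open import Induction.WellFounded using (Acc; acc)
open import Relation.Unary using (Pred; Decidable)
open import Relation.Binary.PropositionalEquality as ≡
  using (_≡_; _≢_; refl; cong; subst; trans; ≢-sym; module ≡-Reasoning)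
open import Relation.Binary.Construct.Closure.ReflexiveTransitive using (Star; ε; _◅_)
open import Relation.Nullary using (¬_; yes; no)
open import Relation.Nullary.Decidable using (_×-dec_; _→-dec_; ¬?; decidable-stable)

private
  variable
    n : ℕ
    p c : Subset n
    r s x y : Fin n

[]=outside⇒∉ : p [ x ]= outside → x ∉ p
[]=outside⇒∉ x↦outside x∈p with []=-injective x↦outside x∈p
... | ()

∈∉⇒≢ : x ∈ p → y ∉ p → x ≢ y
∈∉⇒≢ x∈p y∉p refl = y∉p x∈p

x∉p[x]≔outside : ∀ (p : Subset n) x → x ∉ p [ x ]≔ outside
x∉p[x]≔outside p x = []=outside⇒∉ ([]≔-updates p x)

∣p[x]≔outside∣<∣p∣ : x ∈ p → ∣ p [ x ]≔ outside ∣ < ∣ p ∣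
∣p[x]≔outside∣<∣p∣ {p = inside ∷ p}  here        = ≤-refl
∣p[x]≔outside∣<∣p∣ {p = inside ∷ p}  (there x∈p) = s≤s (∣p[x]≔outside∣<∣p∣ x∈p)
∣p[x]≔outside∣<∣p∣ {p = outside ∷ p} (there x∈p) = ∣p[x]≔outside∣<∣p∣ x∈p

1≤∣p∣⇒nonempty : 1 ≤ ∣ p ∣ → Nonempty p
1≤∣p∣⇒nonempty {n} {p} 1≤∣p∣ with nonempty? p
... | yes nonempty = nonempty
... | no empty with subst (1 ≤_) (trans (cong ∣_∣ (Empty-unique empty)) (∣⊥∣≡0 n)) 1≤∣p∣
...   | ()

∁⁅x⁆≡⊤[x]≔outside : ∀ (x : Fin n) → ∁ ⁅ x ⁆ ≡ ⊤ [ x ]≔ outside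
∁⁅x⁆≡⊤[x]≔outside zero    = cong (outside ∷_) (map-replicate not outside _)
∁⁅x⁆≡⊤[x]≔outside (suc x) = cong (inside ∷_) (∁⁅x⁆≡⊤[x]≔outside x)

remove-remove-restore : ∀ (c : Subset n) → s ∈ c → r ≢ s →
  ((c [ s ]≔ outside) [ r ]≔ outside) [ s ]≔ inside ≡ c [ r ]≔ outside
remove-remove-restore {s = s} {r = r} c s∈c r≢s = begin
  ((c [ s ]≔ outside) [ r ]≔ outside) [ s ]≔ inside
    ≡⟨ cong (_[ s ]≔ inside) ([]≔-commutes c s r (≢-sym r≢s)) ⟩
  ((c [ r ]≔ outside) [ s ]≔ outside) [ s ]≔ inside
    ≡⟨ []≔-idempotent (c [ r ]≔ outside) s ⟩
  (c [ r ]≔ outside) [ s ]≔ inside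
    ≡⟨ cong ((c [ r ]≔ outside) [ s ]≔_) (≡.sym s-still-in) ⟩
  (c [ r ]≔ outside) [ s ]≔ lookup (c [ r ]≔ outside) s
    ≡⟨ []≔-lookup (c [ r ]≔ outside) s ⟩
  c [ r ]≔ outside ∎
  where
  open ≡-Reasoning
  s-still-in : lookup (c [ r ]≔ outside) s ≡ inside
  s-still-in = trans (lookup∘update′ (≢-sym r≢s) c outside) ([]=⇒lookup s∈c)

largestSubset : ∀ {ℓ} {P : Pred (Subset n) ℓ} → Decidable P → ∃ P →
  ∃ λ S → P S × (∀ T → P T → ∣ T ∣ ≤ ∣ S ∣)
largestSubset {n} {P = P} P? (p , Pp) = search n (λ T _ → ∣p∣≤n T)
  where
  search : ∀ k → (∀ T → P T → ∣ T ∣ ≤ k) → ∃ λ S → P S × (∀ T → P T → ∣ T ∣ ≤ ∣ S ∣)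
  search k bound with anySubset? (λ S → P? S ×-dec (k ≤? ∣ S ∣))
  ... | yes (S , PS , k≤∣S∣) = S , PS , λ T PT → ≤-trans (bound T PT) k≤∣S∣
  search zero    _ | no none = ⊥-elim (none (p , Pp , z≤n))
  search (suc k) _ | no none = search k (λ T PT → ≮⇒≥ (λ k<∣T∣ → none (T , PT , k<∣T∣)))

MaximumIndependent : Graph n → Subset n → Set
MaximumIndependent H S = Independent H S × (∀ T → Independent H T → ∣ T ∣ ≤ ∣ S ∣)

Dominating : Graph n → Subset n → Set
Dominating H S = ∀ {r} → r ∉ S → ∃ λ s → s ∈ S × r ∼[ H ] s

module _ (H : Graph n) where

  ∼-irrefl : ¬ (x ∼[ H ] x)
  ∼-irrefl {x} x∼x with trans (≡.sym x∼x) (irrefl H x)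
  ... | ()

  independent? : Decidable (Independent H)
  independent? S = all? λ x → all? λ y →
    x ∈? S →-dec (y ∈? S →-dec ¬? (adj H x y ≟ᵇ true))

  ⁅x⁆-independent : ∀ x → Independent H ⁅ x ⁆
  ⁅x⁆-independent x y z y∈ z∈ y∼z
    with refl ← x∈⁅y⁆⇒x≡y x y∈ | refl ← x∈⁅y⁆⇒x≡y x z∈ = ∼-irrefl y∼z

  -- Adding a vertex without neighbours in S would give a larger independent set.
  maximum⇒dominating : ∀ {S} → MaximumIndependent H S → Dominating H S
  maximum⇒dominating {S} (indS , maxS) {r} r∉S
    with any? (λ s → s ∈? S ×-dec (adj H r s ≟ᵇ true))
  ... | yes found = found
  ... | no none = ⊥-elim (<-irrefl refl (<-≤-trans (p⊂q⇒∣p∣<∣q∣ S⊂S∪r) (maxS _ indS∪r)))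
    where
    S⊂S∪r : S ⊂ S ∪ ⁅ r ⁆
    S⊂S∪r = p⊆p∪q ⁅ r ⁆ , r , x∈p∪q⁺ (inj₂ (x∈⁅x⁆ r)) , r∉S
    indS∪r : Independent H (S ∪ ⁅ r ⁆)
    indS∪r x y x∈ y∈ x∼y with x∈p∪q⁻ S ⁅ r ⁆ x∈ | x∈p∪q⁻ S ⁅ r ⁆ y∈
    ... | inj₁ x∈S | inj₁ y∈S = indS x y x∈S y∈S x∼y
    ... | inj₁ x∈S | inj₂ y∈r with refl ← x∈⁅y⁆⇒x≡y r y∈r = none (x , x∈S , trans (sym H r x) x∼y)
    ... | inj₂ x∈r | inj₁ y∈S with refl ← x∈⁅y⁆⇒x≡y r x∈r = none (y , y∈S , x∼y)
    ... | inj₂ x∈r | inj₂ y∈r = ⁅x⁆-independent r x y x∈r y∈r x∼y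

  independent⇒jumpFree : ∀ {T} → Independent H T → ∀ c → ¬ Jump H T c
  independent⇒jumpFree ind _ (x , y , _ , x∼y , _ , _ , x∈T , y∈T , _) = ind x y x∈T y∈T x∼y

  jump⇒hole : ∀ {c c′} → Jump H c c′ → ∃ (_∉ c′)
  jump⇒hole {c} (x , y , z , _ , _ , x≢z , _ , _ , _ , refl) with x ≟ y
  ... | yes refl = x , []=outside⇒∉ ([]≔-minimal _ x z x≢z ([]≔-updates _ x))
  ... | no x≢y   = x , []=outside⇒∉ ([]≔-minimal _ x z x≢z ([]≔-minimal _ x y x≢y ([]≔-updates c x)))

  reachable⇒hole : ∀ {c c′} → ∃ (_∉ c) → Star (Jump H) c c′ → ∃ (_∉ c′)
  reachable⇒hole hole ε        = hole
  reachable⇒hole _    (j ◅ js) = reachable⇒hole (jump⇒hole j) js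

  terminal⇒hole : ∀ {T} → Terminal H T → ∃ (_∉ T)
  terminal⇒hole ((h , run) , _) = reachable⇒hole (h , x∈p⇒x∉∁p (x∈⁅x⁆ h)) run

module Join {m} (G : Graph m) where

  G∨K₁ : Graph (suc m)
  G∨K₁ = joinK₁ G

  jumpIntoApex : r ∼[ G ] s → r ∈ c → s ∈ c →
    Jump G∨K₁ (outside ∷ c) (inside ∷ ((c [ r ]≔ outside) [ s ]≔ outside))
  jumpIntoApex {r} {s} r∼s r∈c s∈c =
    suc r , suc s , zero , r∼s , refl , (λ ()) , there r∈c , there s∈c , (λ ()) , refl

  jumpOverApex : r ≢ s → r ∈ c → s ∉ c →
    Jump G∨K₁ (inside ∷ c) (outside ∷ ((c [ r ]≔ outside) [ s ]≔ inside))
  jumpOverApex {r} {s} r≢s r∈c s∉c =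
    suc r , zero , suc s , refl , refl , r≢s ∘ suc-injective ,
    there r∈c , here , (λ { (there s∈c) → s∉c s∈c }) , refl

  independent⁺ : ∀ {S} → Independent G S → Independent G∨K₁ (outside ∷ S)
  independent⁺ ind zero    _       ()         _
  independent⁺ ind (suc x) zero    _          ()
  independent⁺ ind (suc x) (suc y) (there x∈S) (there y∈S) = ind x y x∈S y∈S

  independent⁻ : ∀ {S} → Independent G∨K₁ (outside ∷ S) → Independent G S
  independent⁻ ind x y x∈S y∈S = ind (suc x) (suc y) (there x∈S) (there y∈S)

  -- An independent set through the apex is the apex alone.
  independent-bound : ∀ {k} → 1 ≤ k → (∀ T → Independent G T → ∣ T ∣ ≤ k) →
    ∀ S → Independent G∨K₁ S → ∣ S ∣ ≤ k
  independent-bound _   bound (outside ∷ S) ind = bound S (independent⁻ ind)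
  independent-bound {k} 1≤k _ (inside ∷ S) ind =
    subst (_≤ k) (cong suc (≡.sym (trans (cong ∣_∣ S≡⊥) (∣⊥∣≡0 m)))) 1≤k
    where
    S≡⊥ : S ≡ ⊥
    S≡⊥ = Empty-unique λ (x , x∈S) → ind zero (suc x) here (there x∈S) refl

  jumpFree⇒independent : ∀ {T} → ∃ (_∉ T) → (∀ c → ¬ Jump G∨K₁ T c) → Independent G∨K₁ T
  jumpFree⇒independent {outside ∷ T} _ noJump (suc x) (suc y) x∈ y∈ x∼y =
    noJump _ (suc x , suc y , zero , x∼y , refl , (λ ()) , x∈ , y∈ , (λ ()) , refl)
  jumpFree⇒independent {outside ∷ T} _ _ zero    _    () _ _
  jumpFree⇒independent {outside ∷ T} _ _ (suc x) zero _ () _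
  jumpFree⇒independent {inside ∷ T} (zero , apex∉T) _ _ _ _ _ _ = apex∉T here
  jumpFree⇒independent {inside ∷ T} (suc h , h∉) noJump (suc x) _ (there x∈T) _ _ =
    noJump _ (jumpOverApex (∈∉⇒≢ x∈T (drop-not-there h∉)) x∈T (drop-not-there h∉))
  jumpFree⇒independent {inside ∷ T} (suc h , h∉) noJump zero (suc y) _ (there y∈T) _ =
    noJump _ (jumpOverApex (∈∉⇒≢ y∈T (drop-not-there h∉)) y∈T (drop-not-there h∉))
  jumpFree⇒independent {inside ∷ T} (suc _ , _) _ zero zero _ _ ()

  terminal⇒independent : ∀ {T} → Terminal G∨K₁ T → Independent G∨K₁ T
  terminal⇒independent terminal =
    jumpFree⇒independent (terminal⇒hole G∨K₁ terminal) (proj₂ terminal)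

  module Sweep {S : Subset m} (dominating : Dominating G S) where

    _↠S : Config (suc m) → Set
    c ↠S = Star (Jump G∨K₁) c (outside ∷ S)

    Sweepable : Subset m → Set
    Sweepable c = (outside ∷ c) ↠S ⊎ (∀ {s} → s ∈ S → (inside ∷ (c [ s ]≔ outside)) ↠S)

    sweep : ∀ c → Acc _<_ ∣ c ∣ → S ⊆ c → Sweepable c
    sweep c (acc smaller) S⊆c with any? (λ r → r ∈? c ×-dec ¬? (r ∈? S))
    ... | no none = inj₁ (subst (λ d → (outside ∷ d) ↠S) (≡.sym c≡S) ε)
      where
      c≡S : c ≡ S
      c≡S = ⊆-antisym (λ {x} x∈c → decidable-stable (x ∈? S) (λ x∉S → none (x , x∈c , x∉S))) S⊆c
    ... | yes (r , r∈c , r∉S)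
      with sweep (c [ r ]≔ outside) (smaller (∣p[x]≔outside∣<∣p∣ r∈c))
                 (λ {s} s∈S → []≔-minimal c s r (∈∉⇒≢ s∈S r∉S) (S⊆c s∈S))
    ...   | inj₁ fromEmptyApex = inj₂ λ {s} s∈S →
            let r≢s = ≢-sym (∈∉⇒≢ s∈S r∉S) in
            jumpOverApex r≢s ([]≔-minimal c r s r≢s r∈c) (x∉p[x]≔outside c s)
            ◅ subst (λ d → (outside ∷ d) ↠S) (≡.sym (remove-remove-restore c (S⊆c s∈S) r≢s)) fromEmptyApex
    ...   | inj₂ fromHoleIn with dominating r∉S
    ...     | s , s∈S , r∼s = inj₁ (jumpIntoApex r∼s r∈c (S⊆c s∈S) ◅ fromHoleIn s∈S)

    reachable : Nonempty S → ∃ λ h → start h ↠S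
    reachable (s , s∈S) with sweep ⊤ (<-wellFounded _) ⊆⊤
    ... | inj₁ fromEmptyApex =
      zero , subst _↠S (≡.sym (∁⁅x⁆≡⊤[x]≔outside zero)) fromEmptyApex
    ... | inj₂ fromHoleIn =
      suc s , subst _↠S (cong (inside ∷_) (≡.sym (∁⁅x⁆≡⊤[x]≔outside s))) (fromHoleIn s∈S)

  foolsNumber≡independenceNumber : ∀ {S} → MaximumIndependent G S → 1 ≤ ∣ S ∣ →
    IsFoolsNumber G∨K₁ ∣ S ∣ × IsIndependenceNumber G∨K₁ ∣ S ∣
  foolsNumber≡independenceNumber {S} maximum@(indS , maxS) 1≤∣S∣ =
    ((outside ∷ S , terminal , refl) , λ T → bound T ∘ terminal⇒independent) ,
    ((outside ∷ S , independent⁺ indS , refl) , bound)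
    where
    bound : ∀ T → Independent G∨K₁ T → ∣ T ∣ ≤ ∣ S ∣
    bound = independent-bound 1≤∣S∣ maxS
    terminal : Terminal G∨K₁ (outside ∷ S)
    terminal = Sweep.reachable (maximum⇒dominating G maximum) (1≤∣p∣⇒nonempty 1≤∣S∣) ,
               independent⇒jumpFree G∨K₁ (independent⁺ indS)

lemma2p1 : ∀ {n} (G : Graph (suc n)) →
    ∃ λ m → IsFoolsNumber (joinK₁ G) m × IsIndependenceNumber (joinK₁ G) m
lemma2p1 {n} G with largestSubset (independent? G) (⁅ zero ⁆ , ⁅x⁆-independent G zero)
... | S , maximum@(_ , maxS) = ∣ S ∣ , Join.foolsNumber≡independenceNumber G maximum 1≤∣S∣
  where
  1≤∣S∣ : 1 ≤ ∣ S ∣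
  1≤∣S∣ = subst (_≤ ∣ S ∣) (∣⁅x⁆∣≡1 {suc n} zero) (maxS ⁅ zero ⁆ (⁅x⁆-independent G zero))
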